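{- Let $G=(V,E)$ be a directed graph with $V=\{1,\dots,n\}$, $\beta\in(0,1)$, and let $A$ be the constraint matrix of $\mathcal{H}_\beta(G)$ defined below. Let $x=(x_{ij})_{(i,j)\in E}$ be a real vector whose support (set of arcs with $x_{ij}\neq0$) is the arc set of an oriented cycle $\overrightarrow C\subseteq E$ that does not contain node $1$. Then $Ax=0$ if and only if the following three conditions hold: (i) $x_{ij}=-x_{ik}$ whenever node $i$ has out-degree 2 in $\overrightarrow C$ and $(i,j),(i,k)\in\overrightarrow C$; (ii) $x_{ji}=-x_{ki}$ whenever node $i$ has in-degree 2 in $\overrightarrow C$ and $(j,i),(k,i)\in\overrightarrow C$; (iii) $x_{ij}=\beta x_{ki}$ whenever node $i$ has in-degree 1 and out-degree 1 in $\overrightarrow C$ and $(i,j),(k,i)\in\overrightarrow C$.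
   Context: $G=(V,E)$ is a directed graph without loops or multiple arcs; $\mathcal{N}^{+}(i)=\{j:(i,j)\in E\}$, $\mathcal{N}^{ - }(i)=\{j:(j,i)\in E\}$. $A$ is the $(n+1)\times\lvert E\rvert$ matrix (columns indexed by arcs) of the linear forms $\sum_{j\in\mathcal{N}^{+}(1)}x_{1j}-\beta\sum_{j\in\mathcal{N}^{ - }(1)}x_{j1}$; $\sum_{j\in\mathcal{N}^{+}(i)}x_{ij}-\beta\sum_{j\in\mathcal{N}^{ - }(i)}x_{ji}$ for $i\in V\setminus\{1\}$; $\sum_{j\in\mathcal{N}^{+}(1)}x_{1j}$. Oriented cycle: given an undirected cycle $\{v_0,v_1\},\{v_1,v_2\},\dots,\{v_{k-1},v_k\}$ with $v_k=v_0$, $k\ge2$, and $v_0,\dots,v_{k-1}$ distinct nodes, an oriented cycle is a set of arcs $\{(u_1,w_1),\dots,(u_k,w_k)\}\subseteq E$ with $(u_i,w_i)\in\{(v_{i-1},v_i),(v_i,v_{i-1})\}$ for each $i$. In- and out-degrees in $\overrightarrow C$ are computed in the graph formed by these arcs. -}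

module Defs where

open import Level using (0ℓ)
open import Data.Nat as ℕ using (ℕ; zero; suc)
open import Data.Fin as Fin using (Fin; inject₁; fromℕ)
open import Data.Product using (_×_; _,_; proj₁; proj₂; Σ; ∃; ∃-syntax)
open import Data.Sum using (_⊎_)
open import Relation.Nullary using (¬_; yes; no)
open import Relation.Binary.PropositionalEquality using (_≡_; _≢_)
open import Relation.Binary.Structures using (IsStrictTotalOrder)
open import Algebra.Bundles using (CommutativeRing)

-- The real numbers, axiomatised as a (Dedekind-)complete ordered field.
-- The statement quantifies over every such structure.

record RealField : Set₁ where
  field
    commRing : CommutativeRing 0ℓ 0ℓ
  open CommutativeRing commRing public
  field
    _<_            : Carrier → Carrier → Set
    isStrictTotalOrder : IsStrictTotalOrder _≈_ _<_
    +-mono-<       : ∀ {x y} z → x < y → (x + z) < (y + z)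
    *-pos          : ∀ {x y} → 0# < x → 0# < y → 0# < (x * y)
    0<1            : 0# < 1#
    inverse        : ∀ x → ¬ (x ≈ 0#) → ∃[ y ] ((x * y) ≈ 1#)
    complete       : (P : Carrier → Set) → ∃[ a ] P a →
                     ∃[ b ] (∀ a → P a → (a < b ⊎ a ≈ b)) →
                     ∃[ s ] ((∀ a → P a → (a < s ⊎ a ≈ s)) ×
                             (∀ b → (∀ a → P a → (a < b ⊎ a ≈ b)) → (s < b ⊎ s ≈ b)))

-- Directed graphs on the node set V = Fin N (node 1 of the paper is
-- Fin.zero, and N = n). Arcs are indexed by Fin m; arc e = (tail, head).
-- No loops, no multiple arcs.

node1 : ∀ {n} → Fin (suc n)
node1 = Fin.zero

record Digraph (N : ℕ) : Set where
  field
    m       : ℕ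
    arc     : Fin m → Fin N × Fin N
    noLoop  : ∀ e → proj₁ (arc e) ≢ proj₂ (arc e)
    noMulti : ∀ e f → arc e ≡ arc f → e ≡ f

  src tgt : Fin m → Fin N
  src e = proj₁ (arc e)
  tgt e = proj₂ (arc e)

count : ∀ {k N} → (Fin k → Fin N) → Fin N → ℕ
count {zero}  f i = 0
count {suc k} f i with f Fin.zero Fin.≟ i
... | yes _ = suc (count (λ p → f (Fin.suc p)) i)
... | no  _ = count (λ p → f (Fin.suc p)) i

-- Oriented cycles: undirected cycle v₀ v₁ … v_k with v_k = v₀, k ≥ 2,
-- v₀ … v_{k-1} distinct; the p-th arc (p = 0 … k-1, i.e. arc p+1 of the
-- paper) is (v_p , v_{p+1}) or (v_{p+1} , v_p).

module _ {N : ℕ} (G : Digraph N) where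
  open Digraph G

  record OrientedCycle : Set where
    field
      k        : ℕ
      2≤k      : 2 ℕ.≤ k
      v        : Fin (suc k) → Fin N
      closed   : v (fromℕ k) ≡ v Fin.zero
      distinct : ∀ p q → v (inject₁ p) ≡ v (inject₁ q) → p ≡ q
      c        : Fin k → Fin m
      c-inj    : ∀ p q → c p ≡ c q → p ≡ q
      oriented : ∀ p → (arc (c p) ≡ (v (inject₁ p) , v (Fin.suc p)))
                     ⊎ (arc (c p) ≡ (v (Fin.suc p) , v (inject₁ p)))

    _∈C : Fin m → Set
    e ∈C = ∃[ p ] (c p ≡ e)

    outdeg indeg : Fin N → ℕ
    outdeg i = count (λ p → src (c p)) i
    indeg  i = count (λ p → tgt (c p)) i

    onCycle : Fin N → Set
    onCycle i = ∃[ p ] (v (inject₁ p) ≡ i)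

-- The constraint matrix A of H_β(G): rows are the nodes i ∈ V (the row for
-- node 1 and those for i ≠ 1 have the same form) followed by one extra row
-- Σ_{j∈N⁺(1)} x_{1j}. Columns are the arcs.

module _ (ℝ : RealField) where
  open RealField ℝ

  Σ[_] : ∀ {m} → (Fin m → Carrier) → Carrier
  Σ[_] {zero}  f = 0#
  Σ[_] {suc m} f = f Fin.zero + Σ[ (λ e → f (Fin.suc e)) ]

  δ : ∀ {N} → Fin N → Fin N → Carrier
  δ a b with a Fin.≟ b
  ... | yes _ = 1#
  ... | no  _ = 0#

  module _ {n : ℕ} (G : Digraph (suc n)) (β : Carrier) where
    open Digraph G
    open import Data.Unit using (⊤; tt)
    open import Data.Sum using (inj₁; inj₂)

    Row : Set
    Row = Fin (suc n) ⊎ ⊤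

    Amat : Row → Fin m → Carrier
    Amat (inj₁ i) e = δ (src e) i - (β * δ (tgt e) i)
    Amat (inj₂ _) e = δ (src e) node1

    Ax : (Fin m → Carrier) → Row → Carrier
    Ax x r = Σ[ (λ e → Amat r e * x e) ]

    AxZero : (Fin m → Carrier) → Set
    AxZero x = ∀ r → Ax x r ≈ 0#

module Submission where

-- Let x be supported on the arcs of an oriented cycle C = v₀ v₁ … v_k (= v₀)
-- avoiding node 1.  Row i of A x is  Σ_{src e = i} x_e − β Σ_{tgt e = i} x_e,
-- and the extra row only sees arcs leaving node 1.  Hence every row at a node
-- off the cycle, and the extra row, vanish automatically.  At a cycle node
-- i = v_p exactly two cycle arcs are incident, c_p and c_q where v_{q+1} = v_p,
-- so row i reduces to the sum of two terms, each x_e (arc leaving i) or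
-- −β x_e (arc entering i).  Depending on the orientation of these two arcs,
-- "row i = 0" is equivalent, by elementary field algebra (β ≠ 0), to exactly
-- one of the conditions (i), (ii), (iii), and the degrees appearing in those
-- conditions are read off from the same local picture.

open import Defs
open import Data.Nat using (ℕ; suc)
open import Data.Fin using (Fin)
open import Data.Product using (_×_; ∃-syntax)
open import Relation.Nullary using (¬_)
open import Relation.Binary.PropositionalEquality using (_≡_; _≢_)
open import Function.Bundles using (_⇔_)

open import Data.Nat using (zero)
open import Data.Fin using (zero; suc; inject₁; fromℕ; _≟_)
open import Data.Fin.Properties using (any?; suc-injective)
open import Data.Fin.Relation.Unary.Top using (view; ‵fromℕ; ‵inject₁)
open import Data.Product using (_,_; proj₁; proj₂)
open import Data.Sum using (_⊎_; inj₁; inj₂; swap; [_,_]′) renaming (map to ⊎-map)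
open import Data.Unit using (tt)
open import Function.Base using (_∘_)
open import Function.Bundles using (mk⇔; Equivalence)
open import Function.Construct.Composition using (_⇔-∘_)
open import Relation.Nullary using (yes; no; contradiction)
open import Relation.Binary.PropositionalEquality using (refl; sym; trans; cong)
open import Relation.Binary.Structures using (IsStrictTotalOrder)

open Equivalence using (to; from)

module ClosedWalk {A : Set} {k : ℕ} (v : Fin (suc k) → A)
  (closed : v (fromℕ k) ≡ v zero)
  (distinct : ∀ p q → v (inject₁ p) ≡ v (inject₁ q) → p ≡ q) where

  predecessor : (p : Fin k) → ∃[ q ] v (suc q) ≡ v (inject₁ p)
  predecessor zero    = fromℕ _ , closed
  predecessor (suc p) = inject₁ p , refl

  arrival-on-walk : (r : Fin k) → ∃[ s ] v (inject₁ s) ≡ v (suc r)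
  arrival-on-walk r with view r
  ... | ‵fromℕ     = zero , sym closed
  ... | ‵inject₁ j = suc j , refl

  arrival-injective : (r r' : Fin k) → v (suc r) ≡ v (suc r') → r ≡ r'
  arrival-injective r r' eq with view r | view r'
  ... | ‵fromℕ     | ‵fromℕ      = refl
  ... | ‵fromℕ     | ‵inject₁ j' = contradiction (distinct zero (suc j') (trans (sym closed) eq)) λ ()
  ... | ‵inject₁ j | ‵fromℕ      = contradiction (distinct zero (suc j) (trans (sym closed) (sym eq))) λ ()
  ... | ‵inject₁ j | ‵inject₁ j' = cong inject₁ (suc-injective (distinct (suc j) (suc j') eq))

third-of-pair : {A : Set} {a b x y z : A} → (x ≡ a ⊎ x ≡ b) → (y ≡ a ⊎ y ≡ b) →
                (z ≡ a ⊎ z ≡ b) → x ≢ y → z ≡ x ⊎ z ≡ y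
third-of-pair (inj₁ refl) (inj₁ refl) _           x≢y = contradiction refl x≢y
third-of-pair (inj₂ refl) (inj₂ refl) _           x≢y = contradiction refl x≢y
third-of-pair (inj₁ refl) (inj₂ refl) (inj₁ refl) _   = inj₁ refl
third-of-pair (inj₁ refl) (inj₂ refl) (inj₂ refl) _   = inj₂ refl
third-of-pair (inj₂ refl) (inj₁ refl) (inj₁ refl) _   = inj₂ refl
third-of-pair (inj₂ refl) (inj₁ refl) (inj₂ refl) _   = inj₁ refl

count-none : ∀ {k N} (f : Fin k → Fin N) i → (∀ r → f r ≢ i) → count f i ≡ 0
count-none {zero}  f i none = refl
count-none {suc k} f i none with f zero ≟ i
... | yes hit = contradiction hit (none zero)
... | no  _   = count-none (f ∘ suc) i (none ∘ suc)

count-single : ∀ {k N} (f : Fin k → Fin N) i a → f a ≡ i →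
               (∀ r → f r ≡ i → r ≡ a) → count f i ≡ 1
count-single {suc k} f i zero fa only with f zero ≟ i
... | yes _    = cong suc (count-none (f ∘ suc) i λ r hit → contradiction (only (suc r) hit) λ ())
... | no  miss = contradiction fa miss
count-single {suc k} f i (suc a) fa only with f zero ≟ i
... | yes hit = contradiction (only zero hit) λ ()
... | no  _   = count-single (f ∘ suc) i a fa (λ r hit → suc-injective (only (suc r) hit))

count-pair : ∀ {k N} (f : Fin k → Fin N) i a b → a ≢ b → f a ≡ i → f b ≡ i →
             (∀ r → f r ≡ i → r ≡ a ⊎ r ≡ b) → count f i ≡ 2
count-pair {suc k} f i zero    zero    a≢b _  _  _    = contradiction refl a≢b
count-pair {suc k} f i zero    (suc b) _   fa fb only with f zero ≟ i
... | yes _    = cong suc (count-single (f ∘ suc) i b fb λ r hit → tail (only (suc r) hit))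
  where
  tail : ∀ {r} → suc r ≡ zero ⊎ suc r ≡ suc b → r ≡ b
  tail (inj₁ ())
  tail (inj₂ eq) = suc-injective eq
... | no  miss = contradiction fa miss
count-pair {suc k} f i (suc a) zero    _   fa fb only with f zero ≟ i
... | yes _    = cong suc (count-single (f ∘ suc) i a fa λ r hit → tail (only (suc r) hit))
  where
  tail : ∀ {r} → suc r ≡ suc a ⊎ suc r ≡ zero → r ≡ a
  tail (inj₁ eq) = suc-injective eq
  tail (inj₂ ())
... | no  miss = contradiction fb miss
count-pair {suc k} f i (suc a) (suc b) a≢b fa fb only with f zero ≟ i
... | yes hit = contradiction (only zero hit) λ { (inj₁ ()) ; (inj₂ ()) }
... | no  _   = count-pair (f ∘ suc) i a b (a≢b ∘ cong suc) fa fb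
                  (λ r hit → ⊎-map suc-injective suc-injective (only (suc r) hit))

module FieldFacts (ℝ : RealField) where
  open RealField ℝ hiding (zero) renaming (refl to ≈-refl; sym to ≈-sym; trans to ≈-trans)
  open import Algebra.Properties.Ring ring
    using (-0#≈0#; -‿involutive; +-inverseˡ-unique; x∙y⁻¹≈ε⇒x≈y; x≈y⇒x∙y⁻¹≈ε)
  open IsStrictTotalOrder isStrictTotalOrder using (irrefl)
  open import Relation.Binary.Reasoning.Setoid setoid

  Σ-vanishes : ∀ {m} (g : Fin m → Carrier) → (∀ e → g e ≈ 0#) → Σ[_] ℝ g ≈ 0#
  Σ-vanishes {zero}  g g≈0 = ≈-refl
  Σ-vanishes {suc m} g g≈0 =
    ≈-trans (+-cong (g≈0 zero) (Σ-vanishes (g ∘ suc) (g≈0 ∘ suc))) (+-identityˡ 0#)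

  Σ-single : ∀ {m} (g : Fin m → Carrier) a → (∀ e → e ≢ a → g e ≈ 0#) → Σ[_] ℝ g ≈ g a
  Σ-single {suc m} g zero    off =
    ≈-trans (+-congˡ (Σ-vanishes (g ∘ suc) λ e → off (suc e) λ ())) (+-identityʳ (g zero))
  Σ-single {suc m} g (suc a) off =
    ≈-trans (+-cong (off zero λ ())
                    (Σ-single (g ∘ suc) a λ e e≢a → off (suc e) (e≢a ∘ suc-injective)))
            (+-identityˡ (g (suc a)))

  Σ-pair : ∀ {m} (g : Fin m → Carrier) a b → a ≢ b →
           (∀ e → e ≢ a → e ≢ b → g e ≈ 0#) → Σ[_] ℝ g ≈ g a + g b
  Σ-pair {suc m} g zero    zero    a≢b off = contradiction refl a≢b
  Σ-pair {suc m} g zero    (suc b) _   off =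
    +-congˡ (Σ-single (g ∘ suc) b λ e e≢b → off (suc e) (λ ()) (e≢b ∘ suc-injective))
  Σ-pair {suc m} g (suc a) zero    _   off =
    ≈-trans (+-congˡ (Σ-single (g ∘ suc) a λ e e≢a → off (suc e) (e≢a ∘ suc-injective) (λ ())))
          (+-comm (g zero) (g (suc a)))
  Σ-pair {suc m} g (suc a) (suc b) a≢b off =
    ≈-trans (+-cong (off zero (λ ()) (λ ()))
                  (Σ-pair (g ∘ suc) a b (a≢b ∘ cong suc)
                     λ e e≢a e≢b → off (suc e) (e≢a ∘ suc-injective) (e≢b ∘ suc-injective)))
          (+-identityˡ (g (suc a) + g (suc b)))

  δ-same : ∀ {N} {a b : Fin N} → a ≡ b → δ ℝ a b ≈ 1#
  δ-same {a = a} {b} a≡b with a ≟ b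
  ... | yes _   = ≈-refl
  ... | no  a≢b = contradiction a≡b a≢b

  δ-diff : ∀ {N} {a b : Fin N} → a ≢ b → δ ℝ a b ≈ 0#
  δ-diff {a = a} {b} a≢b with a ≟ b
  ... | yes a≡b = contradiction a≡b a≢b
  ... | no  _   = ≈-refl

  positive-nonzero : ∀ {β} → 0# < β → ¬ (β ≈ 0#)
  positive-nonzero 0<β β≈0 = irrefl (≈-sym β≈0) 0<β

  ≈0-cong : ∀ {s t} → s ≈ t → (s ≈ 0#) ⇔ (t ≈ 0#)
  ≈0-cong s≈t = mk⇔ (≈-trans (≈-sym s≈t)) (≈-trans s≈t)

  sum-zero⇔neg : ∀ a b → (a + b ≈ 0#) ⇔ (a ≈ - b)
  sum-zero⇔neg a b = mk⇔ (+-inverseˡ-unique a b)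
                         (λ a≈-b → ≈-trans (+-congʳ a≈-b) (-‿inverseˡ b))

  sub-zero⇔eq : ∀ a b → (a - b ≈ 0#) ⇔ (a ≈ b)
  sub-zero⇔eq a b = mk⇔ (x∙y⁻¹≈ε⇒x≈y a b) x≈y⇒x∙y⁻¹≈ε

  neg-scaled-zero⇔ : ∀ {β} → ¬ (β ≈ 0#) → ∀ s → (- (β * s) ≈ 0#) ⇔ (s ≈ 0#)
  neg-scaled-zero⇔ {β} β≉0 s =
    mk⇔ cancel (λ s≈0 → ≈-trans (-‿cong (≈-trans (*-congˡ s≈0) (zeroʳ β))) -0#≈0#)
    where
    cancel : - (β * s) ≈ 0# → s ≈ 0#
    cancel h with inverse β β≉0
    ... | β⁻¹ , ββ⁻¹≈1 = begin
      s                ≈⟨ *-identityˡ s ⟨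
      1# * s           ≈⟨ *-congʳ (≈-trans (*-comm β⁻¹ β) ββ⁻¹≈1) ⟨
      (β⁻¹ * β) * s    ≈⟨ *-assoc β⁻¹ β s ⟩
      β⁻¹ * (β * s)    ≈⟨ *-congˡ (≈-trans (≈-sym (-‿involutive (β * s))) (-‿cong h)) ⟩
      β⁻¹ * - 0#       ≈⟨ *-congˡ -0#≈0# ⟩
      β⁻¹ * 0#         ≈⟨ zeroʳ β⁻¹ ⟩
      0#               ∎

module CycleGeometry {N : ℕ} (G : Digraph N) (C : OrientedCycle G) where
  open Digraph G
  open OrientedCycle C
  open ClosedWalk v closed distinct

  Incident : Fin N → Fin m → Set
  Incident i e = src e ≡ i ⊎ tgt e ≡ i

  Covers : Fin N → Fin k → Fin k → Set
  Covers i a b = ∀ r → Incident i (c r) → r ≡ a ⊎ r ≡ b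

  leaves⇒¬enters : ∀ e i → src e ≡ i → tgt e ≢ i
  leaves⇒¬enters e i s t = noLoop e (trans s (sym t))

  endpoints : ∀ r → (src (c r) ≡ v (inject₁ r) × tgt (c r) ≡ v (suc r))
                  ⊎ (src (c r) ≡ v (suc r) × tgt (c r) ≡ v (inject₁ r))
  endpoints r with oriented r
  ... | inj₁ eq = inj₁ (cong proj₁ eq , cong proj₂ eq)
  ... | inj₂ eq = inj₂ (cong proj₁ eq , cong proj₂ eq)

  incident-ends : ∀ i r → Incident i (c r) → v (inject₁ r) ≡ i ⊎ v (suc r) ≡ i
  incident-ends i r inc with endpoints r | inc
  ... | inj₁ (s , _) | inj₁ si = inj₁ (trans (sym s) si)
  ... | inj₁ (_ , t) | inj₂ ti = inj₂ (trans (sym t) ti)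
  ... | inj₂ (s , _) | inj₁ si = inj₂ (trans (sym s) si)
  ... | inj₂ (_ , t) | inj₂ ti = inj₁ (trans (sym t) ti)

  incident-onCycle : ∀ i r → Incident i (c r) → onCycle i
  incident-onCycle i r inc with incident-ends i r inc
  ... | inj₁ vr≡i  = r , vr≡i
  ... | inj₂ vr'≡i = proj₁ (arrival-on-walk r) , trans (proj₂ (arrival-on-walk r)) vr'≡i

  pred : Fin k → Fin k
  pred p = proj₁ (predecessor p)

  incident-at-node : ∀ p → Covers (v (inject₁ p)) p (pred p)
  incident-at-node p r inc with incident-ends _ r inc
  ... | inj₁ vr≡vp  = inj₁ (distinct r p vr≡vp)
  ... | inj₂ vr'≡vp = inj₂ (arrival-injective r (pred p) (trans vr'≡vp (sym (proj₂ (predecessor p)))))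

  self-incident : ∀ p → Incident (v (inject₁ p)) (c p)
  self-incident p with endpoints p
  ... | inj₁ (s , _) = inj₁ s
  ... | inj₂ (_ , t) = inj₂ t

  pred-incident : ∀ p → Incident (v (inject₁ p)) (c (pred p))
  pred-incident p with endpoints (pred p)
  ... | inj₁ (_ , t) = inj₂ (trans t (proj₂ (predecessor p)))
  ... | inj₂ (s , _) = inj₁ (trans s (proj₂ (predecessor p)))

  -- c_p and c_{pred p} are different arcs: otherwise c_p would be a loop at v_p
  pred-distinct : ∀ p → p ≢ pred p
  pred-distinct p p≡q with endpoints p | trans (cong (v ∘ suc) p≡q) (proj₂ (predecessor p))
  ... | inj₁ (s , t) | vp'≡vp = noLoop (c p) (trans s (trans (sym vp'≡vp) (sym t)))
  ... | inj₂ (s , t) | vp'≡vp = noLoop (c p) (trans s (trans vp'≡vp (sym t)))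

  covered-by-pair : ∀ i a b → a ≢ b → Incident i (c a) → Incident i (c b) → Covers i a b
  covered-by-pair i a b a≢b inc-a inc-b r inc-r with incident-onCycle i a inc-a
  ... | p , refl = third-of-pair (incident-at-node p a inc-a) (incident-at-node p b inc-b)
                                 (incident-at-node p r inc-r) a≢b

  outdeg-two : ∀ i a b → a ≢ b → src (c a) ≡ i → src (c b) ≡ i → Covers i a b → outdeg i ≡ 2
  outdeg-two i a b a≢b sa sb cov = count-pair (src ∘ c) i a b a≢b sa sb (λ r → cov r ∘ inj₁)

  indeg-two : ∀ i a b → a ≢ b → tgt (c a) ≡ i → tgt (c b) ≡ i → Covers i a b → indeg i ≡ 2
  indeg-two i a b a≢b ta tb cov = count-pair (tgt ∘ c) i a b a≢b ta tb (λ r → cov r ∘ inj₂)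

  degrees-one : ∀ i a b → src (c a) ≡ i → tgt (c b) ≡ i → Covers i a b →
                indeg i ≡ 1 × outdeg i ≡ 1
  degrees-one i a b sa tb cov =
    count-single (tgt ∘ c) i b tb only-entering , count-single (src ∘ c) i a sa only-leaving
    where
    only-leaving : ∀ r → src (c r) ≡ i → r ≡ a
    only-leaving r sr with cov r (inj₁ sr)
    ... | inj₁ r≡a  = r≡a
    ... | inj₂ refl = contradiction tb (leaves⇒¬enters (c r) i sr)
    only-entering : ∀ r → tgt (c r) ≡ i → r ≡ b
    only-entering r tr with cov r (inj₂ tr)
    ... | inj₁ refl = contradiction tr (leaves⇒¬enters (c r) i sa)
    ... | inj₂ r≡b  = r≡b

module Rows (ℝ : RealField) {n : ℕ} (G : Digraph (suc n)) (β : RealField.Carrier ℝ)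
  (C : OrientedCycle G) (x : Fin (Digraph.m G) → RealField.Carrier ℝ)
  (x-off : ∀ e → ¬ OrientedCycle._∈C C e → RealField._≈_ ℝ (x e) (RealField.0# ℝ)) where
  open RealField ℝ hiding (zero) renaming (refl to ≈-refl; sym to ≈-sym; trans to ≈-trans)
  open import Algebra.Properties.Ring ring using (-0#≈0#; -‿+-comm; -‿distribˡ-*)
  open import Relation.Binary.Reasoning.Setoid setoid
  open Digraph G
  open OrientedCycle C
  open FieldFacts ℝ
  open CycleGeometry G C

  rowTerm : Fin (suc n) → Fin m → Carrier
  rowTerm i e = Amat ℝ G β (inj₁ i) e * x e

  rowTerm-leaving : ∀ i e → src e ≡ i → rowTerm i e ≈ x e
  rowTerm-leaving i e s = begin
    (δ ℝ (src e) i - β * δ ℝ (tgt e) i) * x e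
      ≈⟨ *-congʳ (+-cong (δ-same s) (-‿cong (*-congˡ (δ-diff (leaves⇒¬enters e i s))))) ⟩
    (1# - β * 0#) * x e  ≈⟨ *-congʳ (+-congˡ (≈-trans (-‿cong (zeroʳ β)) -0#≈0#)) ⟩
    (1# + 0#) * x e      ≈⟨ *-congʳ (+-identityʳ 1#) ⟩
    1# * x e             ≈⟨ *-identityˡ (x e) ⟩
    x e                  ∎

  rowTerm-entering : ∀ i e → tgt e ≡ i → rowTerm i e ≈ - (β * x e)
  rowTerm-entering i e t = begin
    (δ ℝ (src e) i - β * δ ℝ (tgt e) i) * x e
      ≈⟨ *-congʳ (+-cong (δ-diff (λ s → leaves⇒¬enters e i s t)) (-‿cong (*-congˡ (δ-same t)))) ⟩
    (0# - β * 1#) * x e  ≈⟨ *-congʳ (≈-trans (+-identityˡ _) (-‿cong (*-identityʳ β))) ⟩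
    - β * x e            ≈⟨ -‿distribˡ-* β (x e) ⟨
    - (β * x e)          ∎

  rowTerm-vanishes : ∀ i e → (e ∈C → ¬ Incident i e) → rowTerm i e ≈ 0#
  rowTerm-vanishes i e far with any? (λ r → c r ≟ e)
  ... | no  e∉C = ≈-trans (*-congˡ (x-off e e∉C)) (zeroʳ _)
  ... | yes e∈C = begin
    (δ ℝ (src e) i - β * δ ℝ (tgt e) i) * x e
      ≈⟨ *-congʳ (+-cong (δ-diff (far e∈C ∘ inj₁)) (-‿cong (*-congˡ (δ-diff (far e∈C ∘ inj₂))))) ⟩
    (0# - β * 0#) * x e  ≈⟨ *-congʳ (≈-trans (+-identityˡ _) (≈-trans (-‿cong (zeroʳ β)) -0#≈0#)) ⟩
    0# * x e             ≈⟨ zeroˡ (x e) ⟩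
    0#                   ∎

  -- the extra row vanishes: no cycle arc leaves node 1
  row-extra : (∀ i → onCycle i → i ≢ node1) → Ax ℝ G β x (inj₂ tt) ≈ 0#
  row-extra avoids = Σ-vanishes _ term-vanishes
    where
    term-vanishes : ∀ e → δ ℝ (src e) node1 * x e ≈ 0#
    term-vanishes e with any? (λ r → c r ≟ e)
    ... | no  e∉C     = ≈-trans (*-congˡ (x-off e e∉C)) (zeroʳ _)
    ... | yes (r , refl) =
      ≈-trans (*-congʳ (δ-diff (avoids _ (incident-onCycle _ r (inj₁ refl))))) (zeroˡ _)

  row-offCycle : ∀ i → ¬ onCycle i → Ax ℝ G β x (inj₁ i) ≈ 0#
  row-offCycle i off = Σ-vanishes _ λ e →
    rowTerm-vanishes i e λ { (r , refl) inc → off (incident-onCycle i r inc) }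

  row-pair : ∀ i a b → a ≢ b → Incident i (c a) → Incident i (c b) →
             Ax ℝ G β x (inj₁ i) ≈ rowTerm i (c a) + rowTerm i (c b)
  row-pair i a b a≢b inc-a inc-b = Σ-pair _ (c a) (c b) (a≢b ∘ c-inj a b) others
    where
    others : ∀ e → e ≢ c a → e ≢ c b → rowTerm i e ≈ 0#
    others e e≢a e≢b = rowTerm-vanishes i e λ { (r , refl) inc →
      [ e≢a ∘ cong c , e≢b ∘ cong c ]′ (covered-by-pair i a b a≢b inc-a inc-b r inc) }

  node-leaving-leaving : ∀ i a b → a ≢ b → src (c a) ≡ i → src (c b) ≡ i →
                         (Ax ℝ G β x (inj₁ i) ≈ 0#) ⇔ (x (c a) ≈ - x (c b))
  node-leaving-leaving i a b a≢b sa sb = sum-zero⇔neg _ _ ⇔-∘ ≈0-cong (begin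
    Ax ℝ G β x (inj₁ i)               ≈⟨ row-pair i a b a≢b (inj₁ sa) (inj₁ sb) ⟩
    rowTerm i (c a) + rowTerm i (c b) ≈⟨ +-cong (rowTerm-leaving i _ sa) (rowTerm-leaving i _ sb) ⟩
    x (c a) + x (c b)                 ∎)

  node-entering-entering : ¬ (β ≈ 0#) → ∀ i a b → a ≢ b → tgt (c a) ≡ i → tgt (c b) ≡ i →
                           (Ax ℝ G β x (inj₁ i) ≈ 0#) ⇔ (x (c a) ≈ - x (c b))
  node-entering-entering β≉0 i a b a≢b ta tb =
    sum-zero⇔neg _ _ ⇔-∘ (neg-scaled-zero⇔ β≉0 _ ⇔-∘ ≈0-cong (begin
      Ax ℝ G β x (inj₁ i)               ≈⟨ row-pair i a b a≢b (inj₂ ta) (inj₂ tb) ⟩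
      rowTerm i (c a) + rowTerm i (c b) ≈⟨ +-cong (rowTerm-entering i _ ta) (rowTerm-entering i _ tb) ⟩
      - (β * x (c a)) + - (β * x (c b)) ≈⟨ -‿+-comm (β * x (c a)) (β * x (c b)) ⟩
      - (β * x (c a) + β * x (c b))     ≈⟨ -‿cong (distribˡ β (x (c a)) (x (c b))) ⟨
      - (β * (x (c a) + x (c b)))       ∎))

  node-leaving-entering : ∀ i a b → src (c a) ≡ i → tgt (c b) ≡ i →
                          (Ax ℝ G β x (inj₁ i) ≈ 0#) ⇔ (x (c a) ≈ β * x (c b))
  node-leaving-entering i a b sa tb = sub-zero⇔eq _ _ ⇔-∘ ≈0-cong (begin
    Ax ℝ G β x (inj₁ i)               ≈⟨ row-pair i a b a≢b (inj₁ sa) (inj₂ tb) ⟩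
    rowTerm i (c a) + rowTerm i (c b) ≈⟨ +-cong (rowTerm-leaving i _ sa) (rowTerm-entering i _ tb) ⟩
    x (c a) - β * x (c b)             ∎)
    where
    a≢b : a ≢ b
    a≢b refl = leaves⇒¬enters (c a) i sa tb

  LeavingPairs : Set
  LeavingPairs = ∀ i e f → e ∈C → f ∈C → e ≢ f → src e ≡ i → src f ≡ i →
                 outdeg i ≡ 2 → x e ≈ - x f

  EnteringPairs : Set
  EnteringPairs = ∀ i e f → e ∈C → f ∈C → e ≢ f → tgt e ≡ i → tgt f ≡ i →
                  indeg i ≡ 2 → x e ≈ - x f

  PassingNodes : Set
  PassingNodes = ∀ i e f → e ∈C → f ∈C → src e ≡ i → tgt f ≡ i →
                 indeg i ≡ 1 → outdeg i ≡ 1 → x e ≈ β * x f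

  Conditions : Set
  Conditions = LeavingPairs × EnteringPairs × PassingNodes

  -- A x = 0 forces the local conditions
  conditions-of-AxZero : ¬ (β ≈ 0#) → AxZero ℝ G β x → Conditions
  conditions-of-AxZero β≉0 Ax≈0 = leaving-pair , entering-pair , passing
    where
    leaving-pair : LeavingPairs
    leaving-pair i _ _ (a , refl) (b , refl) e≢f sa sb _ =
      to (node-leaving-leaving i a b (e≢f ∘ cong c) sa sb) (Ax≈0 (inj₁ i))
    entering-pair : EnteringPairs
    entering-pair i _ _ (a , refl) (b , refl) e≢f ta tb _ =
      to (node-entering-entering β≉0 i a b (e≢f ∘ cong c) ta tb) (Ax≈0 (inj₁ i))
    passing : PassingNodes
    passing i _ _ (a , refl) (b , refl) sa tb _ _ =
      to (node-leaving-entering i a b sa tb) (Ax≈0 (inj₁ i))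

  cycle-row : ¬ (β ≈ 0#) → Conditions → ∀ p → Ax ℝ G β x (inj₁ (v (inject₁ p))) ≈ 0#
  cycle-row β≉0 (leaving-pair , entering-pair , passing) p =
    balance (self-incident p) (pred-incident p)
    where
    i : Fin (suc n)
    i = v (inject₁ p)
    q : Fin k
    q = pred p
    p≢q : p ≢ q
    p≢q = pred-distinct p
    cov : Covers i p q
    cov = incident-at-node p
    balance : Incident i (c p) → Incident i (c q) → Ax ℝ G β x (inj₁ i) ≈ 0#
    balance (inj₁ sp) (inj₁ sq) = from (node-leaving-leaving i p q p≢q sp sq)
      (leaving-pair i _ _ (p , refl) (q , refl) (p≢q ∘ c-inj p q) sp sq
        (outdeg-two i p q p≢q sp sq cov))
    balance (inj₂ tp) (inj₂ tq) = from (node-entering-entering β≉0 i p q p≢q tp tq)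
      (entering-pair i _ _ (p , refl) (q , refl) (p≢q ∘ c-inj p q) tp tq
        (indeg-two i p q p≢q tp tq cov))
    balance (inj₁ sp) (inj₂ tq) = from (node-leaving-entering i p q sp tq)
      (passing i _ _ (p , refl) (q , refl) sp tq
        (proj₁ (degrees-one i p q sp tq cov)) (proj₂ (degrees-one i p q sp tq cov)))
    balance (inj₂ tp) (inj₁ sq) = from (node-leaving-entering i q p sq tp)
      (passing i _ _ (q , refl) (p , refl) sq tp
        (proj₁ (degrees-one i q p sq tp (λ r → swap ∘ cov r)))
        (proj₂ (degrees-one i q p sq tp (λ r → swap ∘ cov r))))

  AxZero-of-conditions : ¬ (β ≈ 0#) → (∀ i → onCycle i → i ≢ node1) →
                         Conditions → AxZero ℝ G β x
  AxZero-of-conditions β≉0 avoids conds (inj₂ tt) = row-extra avoids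
  AxZero-of-conditions β≉0 avoids conds (inj₁ i) with any? (λ p → v (inject₁ p) ≟ i)
  ... | no  off        = row-offCycle i off
  ... | yes (p , refl) = cycle-row β≉0 conds p

lemma1 : (ℝ : RealField) → let open RealField ℝ in
    {n : ℕ} (G : Digraph (suc n)) (β : Carrier) → 0# < β → β < 1# →
    (C : OrientedCycle G) → let open Digraph G in let open OrientedCycle C in
    (∀ i → onCycle i → i ≢ node1) →
    (x : Fin m → Carrier) →
    (∀ e → (¬ (x e ≈ 0#) → e ∈C) × (e ∈C → ¬ (x e ≈ 0#))) →
    AxZero ℝ G β x ⇔
      ( (∀ i e f → e ∈C → f ∈C → e ≢ f → src e ≡ i → src f ≡ i →
           outdeg i ≡ 2 → x e ≈ - x f)
      × (∀ i e f → e ∈C → f ∈C → e ≢ f → tgt e ≡ i → tgt f ≡ i →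
           indeg i ≡ 2 → x e ≈ - x f)
      × (∀ i e f → e ∈C → f ∈C → src e ≡ i → tgt f ≡ i →
           indeg i ≡ 1 → outdeg i ≡ 1 → x e ≈ β * x f) )
lemma1 ℝ G β 0<β _ C avoids x support =
  mk⇔ (conditions-of-AxZero β≉0) (AxZero-of-conditions β≉0 avoids)
  where
  open RealField ℝ using (_≈_; 0#; isStrictTotalOrder)
  open IsStrictTotalOrder isStrictTotalOrder using () renaming (_≟_ to _≈?_)
  open FieldFacts ℝ using (positive-nonzero)

  β≉0 : ¬ (β ≈ 0#)
  β≉0 = positive-nonzero 0<β

  -- x vanishes off the cycle (equality in ℝ is decidable)
  x-off : ∀ e → ¬ OrientedCycle._∈C C e → x e ≈ 0#
  x-off e e∉C with x e ≈? 0#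
  ... | yes x≈0 = x≈0
  ... | no  x≉0 = contradiction (proj₁ (support e) x≉0) e∉C

  open Rows ℝ G β C x x-off
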